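{- Let $1\leq n<\omega$, let $A\subseteq(\omega^\omega)^n$ be $\sigma$-projective, and fix a $\sigma$-projective code $[A]$ for $A$. Then a player has a winning strategy in the game (of length $\omega\cdot n$) with payoff set $A$ if and only if that player has a winning strategy in the decoding game for $A$ with respect to $[A]$.
   Context: The $\sigma$-projective sets form the smallest pointclass (of subsets of the spaces $(\omega^\omega)^k$ with the product topology of discrete $\omega$) containing the open sets and closed under complements, countable unions, and projections; $\omega^{\omega\cdot n}$ is identified with $(\omega^\omega)^n$. In the game with payoff $A\subseteq(\omega^\omega)^n$, players I and II alternate playing natural numbers for $\omega\cdot n$ moves producing $(x_1,\dots,x_n)$, and I wins iff it lies in $A$. Fix an enumeration $\{A_{m+1}:m\in\omega\}$ of all basic open and basic closed sets in each $(\omega^\omega)^k$. $\sigma$-projective codes: if $A=A_m$ is basic open or basic closed, $[A]=\langle m\rangle$; if $A=\bigcup_iA_i$, $[A]=\langle[A_0],[A_1],\dots\rangle$; if $A=\bigcap_iA_i$, $[A]=\langle0,[A_0],[A_1],\dots\rangle$; if $A=(\omega^\omega)^k\setminus B$, $[A]=\langle1,[B]\rangle$; if $A=p[B]=\{x:\exists y\,(x,y)\in B\}$, $[A]=\langle2,[B]\rangle$; if $A=u[B]=\{x:\forall y\,(x,y)\in B\}$, $[A]=\langle3,[B]\rangle$. The decoding game for $A$ with respect to $[A]$ is a game of length $\omega^2$: first (the preparation) I and II alternate for $\omega\cdot n$ moves producing reals $x_1,\dots,x_n$; then, with the current tuple of reals $\vec x$ (initially $(x_1,\dots,x_n)$),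 play proceeds recursively according to the code: if the code is $\langle m\rangle$ (basic set $A_m$), the game ends (later moves are irrelevant) and I wins iff $\vec x\in A_m$; if the set is $\bigcup_iA_i$, Player I plays some $k\in\omega$ and play continues (from the current play, without $k$) by the rules for $[A_k]$; if it is $\bigcap_iA_i$, Player II plays $k$ and play continues by the rules for $[A_k]$; if it is a complement $(\omega^\omega)^k\setminus B$, play continues by the rules for $[B]$ with the roles of I and II reversed; if it is $p[B]$, Player I plays a real $y$ in $\omega$ moves (Player II's moves in this stretch being irrelevant) and play continues with tuple $(\vec x,y)$ by the rules for $[B]$; if it is $u[B]$, Player II plays a real $y$ in $\omega$ moves (Player I's moves being irrelevant) and play continues with tuple $(\vec x,y)$ by the rules for $[B]$. -}

module Defs where

open import Data.Nat using (ℕ; zero; suc; _*_)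
open import Data.Bool using (Bool; true; false; if_then_else_)
open import Data.List using (List; []; length)
import Data.List as List
open import Data.Fin using (Fin; toℕ)
open import Data.Vec using (Vec; []; _∷_; _∷ʳ_; lookup)
open import Data.Product using (Σ; _×_; _,_)
open import Data.Empty using (⊥)
open import Relation.Nullary using (¬_)
open import Relation.Binary.PropositionalEquality using (_≡_)

ℝ : Set
ℝ = ℕ → ℕ

Tuple : ℕ → Set
Tuple k = Vec ℝ k

-- Basic open / basic closed sets of (ω^ω)^k.
-- A basic open set is N_{s₁} × ⋯ × N_{sₖ} for finite sequences sᵢ;
-- a basic closed set is the complement of a basic open set.

Extends : List ℕ → ℝ → Set
Extends s x = (i : Fin (length s)) → List.lookup s i ≡ x (toℕ i)

data Basic (k : ℕ) : Set where
  basicOpen   : Vec (List ℕ) k → Basic k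
  basicClosed : Vec (List ℕ) k → Basic k

InNbhd : ∀ {k} → Vec (List ℕ) k → Tuple k → Set
InNbhd ss xs = (i : Fin _) → Extends (lookup ss i) (lookup xs i)

_∈B_ : ∀ {k} → Tuple k → Basic k → Set
xs ∈B basicOpen ss   = InNbhd ss xs
xs ∈B basicClosed ss = ¬ InNbhd ss xs

-- σ-projective codes (as well-founded trees, indexed by the dimension k)

data Code : ℕ → Set where
  basic : ∀ {k} → Basic k → Code k
  union : ∀ {k} → (ℕ → Code k) → Code k
  inter : ∀ {k} → (ℕ → Code k) → Code k
  compl : ∀ {k} → Code k → Code k
  proj  : ∀ {k} → Code (suc k) → Code k
  univ  : ∀ {k} → Code (suc k) → Code k

⟦_⟧ : ∀ {k} → Code k → Tuple k → Set
⟦ basic b ⟧ xs = xs ∈B b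
⟦ union f ⟧ xs = Σ ℕ λ i → ⟦ f i ⟧ xs
⟦ inter f ⟧ xs = (i : ℕ) → ⟦ f i ⟧ xs
⟦ compl c ⟧ xs = ¬ ⟦ c ⟧ xs
⟦ proj c ⟧ xs = Σ ℝ λ y → ⟦ c ⟧ (xs ∷ʳ y)
⟦ univ c ⟧ xs = (y : ℝ) → ⟦ c ⟧ (xs ∷ʳ y)

data Player : Set where
  I II : Player

opp : Player → Player
opp I = II
opp II = I

-- A game tree: a finite (well-founded) succession of stages.
--   end q P   : the game is over; player q wins iff P holds (else the other wins)
--   nat q K   : player q plays a single natural number k, continue with K k
--   block K   : a stretch of ω moves, I at even and II at odd positions,
--               producing z ∈ ω^ω; continue with K z
data Game : Set₁ where
  end   : Player → Set → Game
  nat   : Player → (ℕ → Game) → Game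
  block : (ℝ → Game) → Game

-- strategy within a block of ω moves: from the history of the block so far
Strat : Set
Strat = List ℕ → ℕ

isEven : ℕ → Bool
isEven zero = true
isEven (suc zero) = false
isEven (suc (suc n)) = isEven n

move : Strat → Strat → ℕ → List ℕ → ℕ
move σI σII m h = if isEven m then σI h else σII h

history : Strat → Strat → ℕ → List ℕ
history σI σII zero = []
history σI σII (suc m) =
  history σI σII m List.∷ʳ move σI σII m (history σI σII m)

playBlock : Strat → Strat → ℝ
playBlock σI σII m = move σI σII m (history σI σII m)

playAs : Player → Strat → Strat → ℝ
playAs I  σ τ = playBlock σ τ
playAs II σ τ = playBlock τ σ

-- "player p has a winning strategy in G"
-- (a strategy for the whole game is a strategy for the current stage together
--  with, for each outcome of that stage, a strategy for the rest)
Wins : Player → Game → Set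
Wins I  (end I P)  = P
Wins I  (end II P) = ¬ P
Wins II (end I P)  = ¬ P
Wins II (end II P) = P
Wins I  (nat I K)  = Σ ℕ λ k → Wins I (K k)
Wins I  (nat II K) = (k : ℕ) → Wins I (K k)
Wins II (nat I K)  = (k : ℕ) → Wins II (K k)
Wins II (nat II K) = Σ ℕ λ k → Wins II (K k)
Wins p  (block K)  = Σ Strat λ σ → (τ : Strat) → Wins p (K (playAs p σ τ))

prep : (n : ℕ) → (Tuple n → Game) → Game
prep zero K = K []
prep (suc n) K = block λ x → prep n λ xs → K (x ∷ xs)

payoffGame : (n : ℕ) → (Tuple n → Set) → Game
payoffGame n A = prep n λ xs → end I (A xs)

movesOf : Player → ℝ → ℝ
movesOf I  z m = z (2 * m)
movesOf II z m = z (suc (2 * m))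

-- rules for the code c with current tuple xs; r is the player currently
-- in the role of "I" (roles are swapped at each complement)
decode : ∀ {k} → Player → Code k → Tuple k → Game
decode r (basic b) xs = end r (xs ∈B b)
decode r (union f) xs = nat r λ i → decode r (f i) xs
decode r (inter f) xs = nat (opp r) λ i → decode r (f i) xs
decode r (compl c) xs = decode (opp r) c xs
decode r (proj c) xs = block λ z → decode r c (xs ∷ʳ movesOf r z)
decode r (univ c) xs = block λ z → decode r c (xs ∷ʳ movesOf (opp r) z)

decodingGame : (n : ℕ) → Code n → Game
decodingGame n c = prep n λ xs → decode I c xs

{-# OPTIONS --safe #-}
module Submission where

-- Each stage of the decoding game plays out one clause of ⟦ c ⟧: a natural number or a
-- block of ω moves chosen by the player currently in the role of I is an existential
-- quantifier, one chosen by the opponent a universal one. For a block this is because the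
-- real read off from one player's moves can be made any y by that player (playing y move by
-- move) and is out of the other player's control. A complement swaps the roles, so by
-- induction on c the player in the role of I wins iff x⃗ ∈ ⟦ c ⟧ and the other iff x⃗ ∉ ⟦ c ⟧.
-- Excluded middle is needed where the opponent must exhibit a witness of failure
-- (complements, intersections, universal projections). After the common preparation the two
-- games therefore have the same winner.

open import Defs
open import Data.Nat using (ℕ; zero; suc; _*_; _≤_; ⌊_/2⌋)
open import Data.Nat.Properties using (*-suc; +-comm)
open import Data.Bool using (true; false)
open import Data.List using (List; length)
open import Data.List.Properties using (length-++)
open import Data.Vec using (Vec; []; _∷_; _∷ʳ_)
open import Data.Vec.Relation.Binary.Pointwise.Inductive as Pointwise
  using (Pointwise; []; _∷_)
open import Data.Fin using (toℕ)
open import Data.Product using (Σ; _,_; map₂; curry; uncurry)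
open import Function using (_∘_; const)
open import Function.Bundles using (_⇔_; mk⇔; Equivalence)
import Function.Properties.Equivalence as ⇔
open import Function.Related.TypeIsomorphisms using (¬-cong-⇔)
open import Relation.Nullary using (¬_)
open import Relation.Nullary.Negation using (∃¬⟶¬∀)
open import Relation.Binary.Definitions using (_Respects_)
open import Relation.Binary.PropositionalEquality using (_≡_; _≗_; refl; sym; trans; cong)
open import Axiom.ExcludedMiddle using (ExcludedMiddle)
open import Axiom.DoubleNegationElimination using (em⇒dne)
open import Level using (0ℓ)

open Equivalence using (to; from)

isEven-2* : ∀ m → isEven (2 * m) ≡ true
isEven-2* zero    = refl
isEven-2* (suc m) = trans (cong isEven (*-suc 2 m)) (isEven-2* m)

isEven-1+2* : ∀ m → isEven (suc (2 * m)) ≡ false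
isEven-1+2* zero    = refl
isEven-1+2* (suc m) = trans (cong (isEven ∘ suc) (*-suc 2 m)) (isEven-1+2* m)

⌊2*m/2⌋≡m : ∀ m → ⌊ 2 * m /2⌋ ≡ m
⌊2*m/2⌋≡m zero    = refl
⌊2*m/2⌋≡m (suc m) = trans (cong ⌊_/2⌋ (*-suc 2 m)) (cong suc (⌊2*m/2⌋≡m m))

⌊1+2*m/2⌋≡m : ∀ m → ⌊ suc (2 * m) /2⌋ ≡ m
⌊1+2*m/2⌋≡m zero    = refl
⌊1+2*m/2⌋≡m (suc m) = trans (cong (⌊_/2⌋ ∘ suc) (*-suc 2 m)) (cong suc (⌊1+2*m/2⌋≡m m))

length-history : ∀ σ τ k → length (history σ τ k) ≡ k
length-history σ τ zero    = refl
length-history σ τ (suc k) =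
  trans (length-++ (history σ τ k)) (trans (+-comm _ 1) (cong suc (length-history σ τ k)))

follow : ℝ → Strat
follow y h = y ⌊ length h /2⌋

playBlock-follow-even : ∀ y τ m → playBlock (follow y) τ (2 * m) ≡ y m
playBlock-follow-even y τ m
  rewrite isEven-2* m | length-history (follow y) τ (2 * m) | ⌊2*m/2⌋≡m m = refl

playBlock-follow-odd : ∀ y σ m → playBlock σ (follow y) (suc (2 * m)) ≡ y m
playBlock-follow-odd y σ m
  rewrite isEven-1+2* m | length-history σ (follow y) (suc (2 * m)) | ⌊1+2*m/2⌋≡m m = refl

movesOf-playAs-follow : ∀ p y τ → movesOf p (playAs p (follow y) τ) ≗ y
movesOf-playAs-follow I  y τ = playBlock-follow-even y τ
movesOf-playAs-follow II y τ = playBlock-follow-odd y τ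

movesOf-playAs-opp-follow : ∀ p y σ → movesOf p (playAs (opp p) σ (follow y)) ≗ y
movesOf-playAs-opp-follow I  y σ = playBlock-follow-even y σ
movesOf-playAs-opp-follow II y σ = playBlock-follow-odd y σ

_≋_ : ∀ {k} → Tuple k → Tuple k → Set
_≋_ = Pointwise _≗_

≋-refl : ∀ {k} {xs : Tuple k} → xs ≋ xs
≋-refl = Pointwise.refl (λ _ → refl)

≋-sym : ∀ {k} {xs ys : Tuple k} → xs ≋ ys → ys ≋ xs
≋-sym = Pointwise.sym (λ e → sym ∘ e)

≋-∷ʳ : ∀ {k} {xs ys : Tuple k} {x y} → xs ≋ ys → x ≗ y → (xs ∷ʳ x) ≋ (ys ∷ʳ y)
≋-∷ʳ []       x≗y = x≗y ∷ []
≋-∷ʳ (e ∷ es) x≗y = e ∷ ≋-∷ʳ es x≗y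

InNbhd-resp : ∀ {k} (ss : Vec (List ℕ) k) → InNbhd ss Respects _≋_
InNbhd-resp ss e inN i j = trans (inN i j) (Pointwise.lookup e i (toℕ j))

⟦⟧-resp : ∀ {k} (c : Code k) → ⟦ c ⟧ Respects _≋_
⟦⟧-resp (basic (basicOpen ss))   e = InNbhd-resp ss e
⟦⟧-resp (basic (basicClosed ss)) e = λ ∉ ∈ → ∉ (InNbhd-resp ss (≋-sym e) ∈)
⟦⟧-resp (union f) e (i , x∈) = i , ⟦⟧-resp (f i) e x∈
⟦⟧-resp (inter f) e x∈ i     = ⟦⟧-resp (f i) e (x∈ i)
⟦⟧-resp (compl c) e ∉ ∈      = ∉ (⟦⟧-resp c (≋-sym e) ∈)
⟦⟧-resp (proj c)  e (y , x∈) = y , ⟦⟧-resp c (≋-∷ʳ e (λ _ → refl)) x∈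
⟦⟧-resp (univ c)  e x∈ y     = ⟦⟧-resp c (≋-∷ʳ e (λ _ → refl)) (x∈ y)

⟦⟧-cong : ∀ {k} (c : Code k) {xs ys} → xs ≋ ys → ⟦ c ⟧ xs ⇔ ⟦ c ⟧ ys
⟦⟧-cong c e = mk⇔ (⟦⟧-resp c e) (⟦⟧-resp c (≋-sym e))

Σ-cong-⇔ : ∀ {A : Set} {R S : A → Set} → (∀ a → R a ⇔ S a) → Σ A R ⇔ Σ A S
Σ-cong-⇔ e = mk⇔ (map₂ (to (e _))) (map₂ (from (e _)))

Π-cong-⇔ : ∀ {A : Set} {R S : A → Set} → (∀ a → R a ⇔ S a) → (∀ a → R a) ⇔ (∀ a → S a)
Π-cong-⇔ e = mk⇔ (λ r a → to (e a) (r a)) (λ s a → from (e a) (s a))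

Quant : Player → Player → {A : Set} → (A → Set) → Set
Quant I  I  R = Σ _ R
Quant II II R = Σ _ R
Quant I  II R = ∀ a → R a
Quant II I  R = ∀ a → R a

quant-cong : ∀ p q {A} {R S : A → Set} → (∀ a → R a ⇔ S a) → Quant p q R ⇔ Quant p q S
quant-cong I  I  = Σ-cong-⇔
quant-cong II II = Σ-cong-⇔
quant-cong I  II = Π-cong-⇔
quant-cong II I  = Π-cong-⇔

end-cong : ∀ p r {P Q} → P ⇔ Q → Wins p (end r P) ⇔ Wins p (end r Q)
end-cong I  I  = λ e → e
end-cong II II = λ e → e
end-cong I  II = ¬-cong-⇔
end-cong II I  = ¬-cong-⇔

quant-end-Σ : ∀ p r {A} (P : A → Set) →
  Quant p r (λ a → Wins p (end r (P a))) ⇔ Wins p (end r (Σ A P))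
quant-end-Σ I  I  P = ⇔.refl
quant-end-Σ II II P = ⇔.refl
quant-end-Σ I  II P = mk⇔ uncurry curry
quant-end-Σ II I  P = mk⇔ uncurry curry

wins-nat : ∀ p q K → Wins p (nat q K) ⇔ Quant p q (λ k → Wins p (K k))
wins-nat I  I  K = ⇔.refl
wins-nat II II K = ⇔.refl
wins-nat I  II K = ⇔.refl
wins-nat II I  K = ⇔.refl

module _ {W R : ℝ → Set} (R-resp : R Respects _≗_) where

  play-own-real : ∀ p → (∀ z → W z ⇔ R (movesOf p z)) →
    (Σ Strat λ σ → ∀ τ → W (playAs p σ τ)) ⇔ Σ ℝ R
  play-own-real p e = mk⇔
    (λ (σ , win) → movesOf p (playAs p σ (const 0)) , to (e _) (win (const 0)))
    (λ (y , Ry) → follow y , λ τ →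
      from (e _) (R-resp (sym ∘ movesOf-playAs-follow p y τ) Ry))

  play-opponent-real : ∀ q → (∀ z → W z ⇔ R (movesOf q z)) →
    (Σ Strat λ σ → ∀ τ → W (playAs (opp q) σ τ)) ⇔ (∀ y → R y)
  play-opponent-real q e = mk⇔
    (λ (σ , win) y → R-resp (movesOf-playAs-opp-follow q y σ) (to (e _) (win (follow y))))
    (λ all → const 0 , λ τ → from (e _) (all _))

wins-block : ∀ p q K {R} → R Respects _≗_ → (∀ z → Wins p (K z) ⇔ R (movesOf q z)) →
  Wins p (block K) ⇔ Quant p q R
wins-block I  I  K R-resp = play-own-real R-resp I
wins-block II II K R-resp = play-own-real R-resp II
wins-block I  II K R-resp = play-opponent-real R-resp II
wins-block II I  K R-resp = play-opponent-real R-resp I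

block-cong : ∀ p {K K'} → (∀ z → Wins p (K z) ⇔ Wins p (K' z)) →
  Wins p (block K) ⇔ Wins p (block K')
block-cong I  e = Σ-cong-⇔ λ σ → Π-cong-⇔ λ τ → e (playAs I σ τ)
block-cong II e = Σ-cong-⇔ λ σ → Π-cong-⇔ λ τ → e (playAs II σ τ)

prep-cong : ∀ p n {K K'} → (∀ xs → Wins p (K xs) ⇔ Wins p (K' xs)) →
  Wins p (prep n K) ⇔ Wins p (prep n K')
prep-cong p zero    e = e []
prep-cong p (suc n) e = block-cong p λ x → prep-cong p n λ xs → e (x ∷ xs)

end-⟦⟧-∷ʳ-resp : ∀ p r {k} (c : Code (suc k)) xs →
  (λ y → Wins p (end r (⟦ c ⟧ (xs ∷ʳ y)))) Respects _≗_
end-⟦⟧-∷ʳ-resp p r c xs e = to (end-cong p r (⟦⟧-cong c (≋-∷ʳ ≋-refl e)))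

module Classical (em : ExcludedMiddle 0ℓ) where

  ¬∀⟶∃¬ : ∀ {A : Set} {P : A → Set} → ¬ (∀ a → P a) → Σ A (¬_ ∘ P)
  ¬∀⟶∃¬ ¬∀ = em⇒dne em λ ¬∃ → ¬∀ λ a → em⇒dne em λ ¬Pa → ¬∃ (a , ¬Pa)

  end-opp : ∀ p r {P} → Wins p (end (opp r) P) ⇔ Wins p (end r (¬ P))
  end-opp I  I  = ⇔.refl
  end-opp II II = ⇔.refl
  end-opp I  II = mk⇔ (λ x ¬x → ¬x x) (em⇒dne em)
  end-opp II I  = mk⇔ (λ x ¬x → ¬x x) (em⇒dne em)

  quant-opp-end-Π : ∀ p r {A} (P : A → Set) →
    Quant p (opp r) (λ a → Wins p (end r (P a))) ⇔ Wins p (end r (∀ a → P a))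
  quant-opp-end-Π I  I  P = ⇔.refl
  quant-opp-end-Π II II P = ⇔.refl
  quant-opp-end-Π I  II P = mk⇔ ∃¬⟶¬∀ ¬∀⟶∃¬
  quant-opp-end-Π II I  P = mk⇔ ∃¬⟶¬∀ ¬∀⟶∃¬

  decode-correct : ∀ {k} p r (c : Code k) xs →
    Wins p (decode r c xs) ⇔ Wins p (end r (⟦ c ⟧ xs))
  decode-correct p r (basic b) xs = ⇔.refl
  decode-correct p r (union f) xs = ⇔.trans
    (⇔.trans (wins-nat p r _) (quant-cong p r λ i → decode-correct p r (f i) xs))
    (quant-end-Σ p r _)
  decode-correct p r (inter f) xs = ⇔.trans
    (⇔.trans (wins-nat p (opp r) _) (quant-cong p (opp r) λ i → decode-correct p r (f i) xs))
    (quant-opp-end-Π p r _)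
  decode-correct p r (compl c) xs = ⇔.trans (decode-correct p (opp r) c xs) (end-opp p r)
  decode-correct p r (proj c) xs = ⇔.trans
    (wins-block p r _ (end-⟦⟧-∷ʳ-resp p r c xs) λ z → decode-correct p r c (xs ∷ʳ movesOf r z))
    (quant-end-Σ p r _)
  decode-correct p r (univ c) xs = ⇔.trans
    (wins-block p (opp r) _ (end-⟦⟧-∷ʳ-resp p r c xs) λ z →
      decode-correct p r c (xs ∷ʳ movesOf (opp r) z))
    (quant-opp-end-Π p r _)

lemma3p5 : ExcludedMiddle 0ℓ →
    (n : ℕ) → 1 ≤ n → (A : Tuple n → Set) → (c : Code n) →
    ((xs : Tuple n) → A xs ⇔ ⟦ c ⟧ xs) →
    (p : Player) → Wins p (payoffGame n A) ⇔ Wins p (decodingGame n c)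
lemma3p5 em n _ A c A⇔c p = prep-cong p n λ xs →
  ⇔.trans (end-cong p I (A⇔c xs)) (⇔.sym (decode-correct p I c xs))
  where open Classical em
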